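{- For any set $\Gamma$ of formulas and formula $\varphi$ of a first-order language $L$, if $\Gamma\vdash\varphi$ (i.e., $\varphi$ is provable in classical first-order logic with identity from assumptions in $\Gamma$), then for every first-order possibility model $\mathfrak{A}$ for $L$, every possibility $s$ of $\mathfrak{A}$, and every variable assignment $g$, if $\mathfrak{A},s\Vdash_g\psi$ for all $\psi\in\Gamma$, then $\mathfrak{A},s\Vdash_g\varphi$.
   Context: Let $L$ be a first-order language (with identity and function symbols; constants are $0$-ary function symbols). A first-order possibility model for $L$ is a tuple $\mathfrak{A}=(S,\sqsubseteq,D,\asymp,V)$ where $(S,\sqsubseteq)$ is a poset; $D$ is a nonempty set; $\asymp$ assigns to each $s\in S$ an equivalence relation $\asymp_s$ on $D$ such that (persistence) if $a\asymp_s b$ and $s'\sqsubseteq s$ then $a\asymp_{s'}b$, and (refinability) if $a\not\asymp_s b$ then $\exists s'\sqsubseteq s\ \forall s''\sqsubseteq s'\ a\not\asymp_{s''}b$; $V$ assigns to each $n$-ary predicate $R$ and $s\in S$ a set $V(R,s)\subseteq D^n$ and to each $n$-ary function symbol $f$ and $s$ a set $V(f,s)\subseteq D^{n+1}$ such that: (persistence for $R$) if $\overline a\in V(R,s)$, $s'\sqsubseteq s$ and $\overline a\asymp_{s'}\overline b$ (componentwise), then $\overline b\in V(R,s')$; (refinability for $R$) if $\overline a\notin V(R,s)$ then $\exists s'\sqsubseteq s\ \forall s''\sqsubseteq s'\ \overline a\notin V(R,s'')$; (persistence for $f$) likewise with $V(f,\cdot)$; (quasi-functionality) if $(\overline a,b),(\overline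 a,b')\in V(f,s)$ then $b\asymp_s b'$; (eventual definedness) for all $\overline a\in D^n$ there are $s'\sqsubseteq s$ and $b\in D$ with $(\overline a,b)\in V(f,s')$. For $s\in S$ and an assignment $g$ of elements of $D$ to variables, the denotation $\mathrm{den}_{\mathfrak{A},s,g}(t)\subseteq D$ of a term $t$ is defined by: $\mathrm{den}_{\mathfrak{A},s,g}(x)=\{a\in D\mid a\asymp_s g(x)\}$ for a variable $x$, and $\mathrm{den}_{\mathfrak{A},s,g}(f(t_1,\dots,t_n))=\{b\in D\mid \exists a_1,\dots,a_n$ with $a_i\in\mathrm{den}_{\mathfrak{A},s,g}(t_i)$ and $(a_1,\dots,a_n,b)\in V(f,s)\}$. For $\asymp_s$-classes $\xi_1,\dots,\xi_n$, say $(\xi_1,\dots,\xi_n)\in I_\asymp(R,s)$ iff there are $a_i\in\xi_i$ with $(a_1,\dots,a_n)\in V(R,s)$. Satisfaction: $\mathfrak{A},s\Vdash_g t_1=t_2$ iff for all $s'\sqsubseteq s$, if each $\mathrm{den}_{\mathfrak{A},s',g}(t_i)$ is nonempty then $\mathrm{den}_{\mathfrak{A},s',g}(t_1)=\mathrm{den}_{\mathfrak{A},s',g}(t_2)$; $\mathfrak{A},s\Vdash_g R(t_1,\dots,t_n)$ iff for all $s'\sqsubseteq s$, if each $\mathrm{den}_{\mathfrak{A},s',g}(t_i)$ is nonempty then $(\mathrm{den}_{\mathfrak{A},s',g}(t_1),\dots,\mathrm{den}_{\mathfrak{A},s',g}(t_n))\in I_\asymp(R,s')$; $\mathfrak{A},s\Vdash_g\neg\varphi$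 iff for all $s'\sqsubseteq s$, $\mathfrak{A},s'\nVdash_g\varphi$; $\mathfrak{A},s\Vdash_g\varphi\wedge\psi$ iff both conjuncts hold; $\mathfrak{A},s\Vdash_g\forall x\varphi$ iff for all $a\in D$, $\mathfrak{A},s\Vdash_{g[x:=a]}\varphi$. Other connectives and $\exists$ are defined classically. -}

module Defs where

open import Level using (Level; Lift) renaming (suc to lsuc)
open import Data.Nat using (ℕ; _≡ᵇ_)
open import Data.Bool using (Bool; true; false; not; _∧_; _∨_; if_then_else_; T)
open import Data.Vec using (Vec; []; _∷_)
open import Data.Vec.Relation.Binary.Pointwise.Inductive using (Pointwise)
open import Data.Vec.Relation.Unary.All using (All)
open import Data.Product using (Σ; _×_; _,_)
open import Data.Unit using (⊤)
open import Relation.Nullary using (¬_)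
open import Relation.Binary.PropositionalEquality using (_≡_)
open import Relation.Binary using (IsPartialOrder; IsEquivalence)

-- Languages: predicate and function symbols with arities
-- (constants are 0-ary function symbols; identity is built in).

record Language : Set₁ where
  field
    Pred   : Set
    Fun    : Set
    parity : Pred → ℕ
    farity : Fun → ℕ
open Language public

Var : Set
Var = ℕ

data Term (L : Language) : Set where
  var : Var → Term L
  fun : (f : Fun L) → Vec (Term L) (farity L f) → Term L

-- Primitive connectives: =, R, ¬, ∧, ∀ ; the rest are classical abbreviations.
data Formula (L : Language) : Set where
  _≐_  : Term L → Term L → Formula L
  rel  : (R : Pred L) → Vec (Term L) (parity L R) → Formula L
  ¬′   : Formula L → Formula L
  _∧′_ : Formula L → Formula L → Formula L
  ∀′   : Var → Formula L → Formula L

module _ {L : Language} where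

  _∨′_ : Formula L → Formula L → Formula L
  φ ∨′ ψ = ¬′ (¬′ φ ∧′ ¬′ ψ)

  _⇒_ : Formula L → Formula L → Formula L
  φ ⇒ ψ = ¬′ (φ ∧′ ¬′ ψ)

  ∃′ : Var → Formula L → Formula L
  ∃′ x φ = ¬′ (∀′ x (¬′ φ))

  mutual
    occursT : Var → Term L → Bool
    occursT x (var y)    = x ≡ᵇ y
    occursT x (fun f ts) = occursV x ts

    occursV : ∀ {n} → Var → Vec (Term L) n → Bool
    occursV x []       = false
    occursV x (t ∷ ts) = occursT x t ∨ occursV x ts

  free : Var → Formula L → Bool
  free x (t ≐ u)    = occursT x t ∨ occursT x u
  free x (rel R ts) = occursV x ts
  free x (¬′ φ)     = free x φ
  free x (φ ∧′ ψ)   = free x φ ∨ free x ψ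
  free x (∀′ y φ)   = not (x ≡ᵇ y) ∧ free x φ

  mutual
    substT : Var → Term L → Term L → Term L
    substT x t (var y)    = if y ≡ᵇ x then t else var y
    substT x t (fun f us) = fun f (substV x t us)

    substV : ∀ {n} → Var → Term L → Vec (Term L) n → Vec (Term L) n
    substV x t []       = []
    substV x t (u ∷ us) = substT x t u ∷ substV x t us

  _[_/_] : Formula L → Term L → Var → Formula L
  (u ≐ v)    [ t / x ] = substT x t u ≐ substT x t v
  (rel R us) [ t / x ] = rel R (substV x t us)
  (¬′ φ)     [ t / x ] = ¬′ (φ [ t / x ])
  (φ ∧′ ψ)   [ t / x ] = (φ [ t / x ]) ∧′ (ψ [ t / x ])
  (∀′ y φ)   [ t / x ] = if y ≡ᵇ x then ∀′ y φ else ∀′ y (φ [ t / x ])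

  substitutable : Term L → Var → Formula L → Bool
  substitutable t x (u ≐ v)    = true
  substitutable t x (rel R us) = true
  substitutable t x (¬′ φ)     = substitutable t x φ
  substitutable t x (φ ∧′ ψ)   = substitutable t x φ ∧ substitutable t x ψ
  substitutable t x (∀′ y φ)   =
    not (free x (∀′ y φ)) ∨ (not (occursT y t) ∧ substitutable t x φ)

  mutual
    data ReplT (x y : Var) : Term L → Term L → Set where
      keep : ∀ z → ReplT x y (var z) (var z)
      swap : ReplT x y (var x) (var y)
      cfun : ∀ f {ts ts'} → ReplV x y ts ts' → ReplT x y (fun f ts) (fun f ts')

    data ReplV (x y : Var) : ∀ {n} → Vec (Term L) n → Vec (Term L) n → Set where
      []  : ReplV x y [] []
      _∷_ : ∀ {n t t'} {ts ts' : Vec (Term L) n} →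
            ReplT x y t t' → ReplV x y ts ts' → ReplV x y (t ∷ ts) (t' ∷ ts')

  data ReplAtom (x y : Var) : Formula L → Formula L → Set where
    req  : ∀ {t u t' u'} → ReplT x y t t' → ReplT x y u u' →
           ReplAtom x y (t ≐ u) (t' ≐ u')
    rrel : ∀ R {ts ts'} → ReplV x y ts ts' → ReplAtom x y (rel R ts) (rel R ts')

  -- Tautologies: true under every truth assignment to prime formulas
  -- (atomic formulas and universally quantified formulas).

  evalP : (Formula L → Bool) → Formula L → Bool
  evalP v (t ≐ u)    = v (t ≐ u)
  evalP v (rel R ts) = v (rel R ts)
  evalP v (¬′ φ)     = not (evalP v φ)
  evalP v (φ ∧′ ψ)   = evalP v φ ∧ evalP v ψ
  evalP v (∀′ x φ)   = v (∀′ x φ)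

  Tautology : Formula L → Set
  Tautology φ = (v : Formula L → Bool) → evalP v φ ≡ true

  -- Enderton's Hilbert system for classical first-order logic with
  -- identity: logical axioms are all generalizations of the following,
  -- and the only rule is modus ponens.

  data BaseAxiom : Formula L → Set where
    ax-taut : ∀ {φ} → Tautology φ → BaseAxiom φ
    ax-inst : ∀ {x φ t} → T (substitutable t x φ) →
              BaseAxiom (∀′ x φ ⇒ (φ [ t / x ]))
    ax-dist : ∀ {x φ ψ} → BaseAxiom (∀′ x (φ ⇒ ψ) ⇒ (∀′ x φ ⇒ ∀′ x ψ))
    ax-vac  : ∀ {x φ} → T (not (free x φ)) → BaseAxiom (φ ⇒ ∀′ x φ)
    ax-refl : ∀ {x} → BaseAxiom (var x ≐ var x)
    ax-leib : ∀ {x y α α'} → ReplAtom x y α α' →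
              BaseAxiom ((var x ≐ var y) ⇒ (α ⇒ α'))

  data LogicalAxiom : Formula L → Set where
    base : ∀ {φ} → BaseAxiom φ → LogicalAxiom φ
    gen  : ∀ {φ} x → LogicalAxiom φ → LogicalAxiom (∀′ x φ)

  data _⊢_ (Γ : Formula L → Set) : Formula L → Set where
    assum : ∀ {φ} → Γ φ → Γ ⊢ φ
    axiom : ∀ {φ} → LogicalAxiom φ → Γ ⊢ φ
    mp    : ∀ {φ ψ} → Γ ⊢ (φ ⇒ ψ) → Γ ⊢ φ → Γ ⊢ ψ

record Model (L : Language) (ℓ : Level) : Set (lsuc ℓ) where
  field
    S      : Set ℓ
    _⊑_    : S → S → Set ℓ
    ⊑-po   : IsPartialOrder _≡_ _⊑_
    D      : Set ℓ
    d₀     : D                                   -- D is nonempty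
    _≍[_]_ : D → S → D → Set ℓ
    ≍-equiv : ∀ s → IsEquivalence (λ a b → a ≍[ s ] b)
    ≍-pers  : ∀ {s s' a b} → a ≍[ s ] b → s' ⊑ s → a ≍[ s' ] b
    ≍-ref   : ∀ {s a b} → ¬ (a ≍[ s ] b) →
              Σ S λ s' → s' ⊑ s × (∀ s'' → s'' ⊑ s' → ¬ (a ≍[ s'' ] b))
    VR     : (R : Pred L) → S → Vec D (parity L R) → Set ℓ
    VR-pers : ∀ {R s s'} {as bs : Vec D (parity L R)} →
              VR R s as → s' ⊑ s → Pointwise (λ a b → a ≍[ s' ] b) as bs → VR R s' bs
    VR-ref  : ∀ {R s as} → ¬ VR R s as →
              Σ S λ s' → s' ⊑ s × (∀ s'' → s'' ⊑ s' → ¬ VR R s'' as)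
    -- V(f,s) ⊆ D^(n+1), represented as a relation between argument tuples and values
    VF     : (f : Fun L) → S → Vec D (farity L f) → D → Set ℓ
    VF-pers : ∀ {f s s' b b'} {as bs : Vec D (farity L f)} →
              VF f s as b → s' ⊑ s → Pointwise (λ a c → a ≍[ s' ] c) as bs →
              b ≍[ s' ] b' → VF f s' bs b'
    VF-qf   : ∀ {f s as b b'} → VF f s as b → VF f s as b' → b ≍[ s ] b'
    VF-ed   : ∀ f s (as : Vec D (farity L f)) →
              Σ S λ s' → s' ⊑ s × Σ D λ b → VF f s' as b

module _ {L : Language} {ℓ : Level} (M : Model L ℓ) where
  open Model M

  Assignment : Set ℓ
  Assignment = Var → D

  _[_↦_] : Assignment → Var → D → Assignment
  (g [ x ↦ a ]) y = if y ≡ᵇ x then a else g y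

  mutual
    den : S → Assignment → Term L → D → Set ℓ
    den s g (var x)    a = a ≍[ s ] g x
    den s g (fun f ts) b = Σ (Vec D (farity L f)) λ as → denV s g ts as × VF f s as b

    denV : ∀ {n} → S → Assignment → Vec (Term L) n → Vec D n → Set ℓ
    denV s g []       []       = Lift ℓ ⊤
    denV s g (t ∷ ts) (a ∷ as) = den s g t a × denV s g ts as

  Nonempty : S → Assignment → Term L → Set ℓ
  Nonempty s g t = Σ D (den s g t)

  sat : S → Assignment → Formula L → Set ℓ
  sat s g (t ≐ u) = ∀ s' → s' ⊑ s → Nonempty s' g t → Nonempty s' g u →
    (∀ a → den s' g t a → den s' g u a) × (∀ a → den s' g u a → den s' g t a)
  sat s g (rel R ts) = ∀ s' → s' ⊑ s → All (Nonempty s' g) ts →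
    Σ (Vec D (parity L R)) λ as → denV s' g ts as × VR R s' as
  sat s g (¬′ φ)   = ∀ s' → s' ⊑ s → ¬ sat s' g φ
  sat s g (φ ∧′ ψ) = sat s g φ × sat s g ψ
  sat s g (∀′ x φ) = ∀ (a : D) → sat s (g [ x ↦ a ]) φ

-- Forcing is persistent and, given excluded middle, refinable: s ⊩ φ as soon
-- as every refinement of s has a further refinement forcing φ.  Refinability
-- yields modus ponens, and it yields every tautology, because densely below
-- any possibility there is one deciding each prime subformula, where the
-- tautology is then read off a Boolean valuation.  An atom is forced exactly
-- when every choice of denotations at every refinement satisfies it; so the
-- identity axioms reduce to denotations respecting ≍, and the quantifier
-- axioms to coincidence and substitution lemmas for denotations.

module Submission where

open import Defs
open import Level using (Level; lift)
open import Axiom.ExcludedMiddle using (ExcludedMiddle)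
open import Axiom.DoubleNegationElimination using (em⇒dne)
open import Data.Nat using (_≡ᵇ_; _≟_)
open import Data.Nat.Properties using (≡ᵇ⇒≡; ≡⇒≡ᵇ)
open import Data.Bool using (Bool; true; false; not; _∧_; _∨_; if_then_else_; T)
open import Data.Bool.Properties using (T-∧; T-∨; T-≡; T-not-≡; ∨-conicalˡ; ∨-conicalʳ)
open import Data.Vec using (Vec; []; _∷_)
open import Data.Vec.Relation.Binary.Pointwise.Inductive as Pointwise using (Pointwise; []; _∷_)
open import Data.Vec.Relation.Unary.All using (All; []; _∷_)
open import Data.Product using (∃; _×_; _,_; proj₁; proj₂)
open import Data.Product.Function.NonDependent.Propositional using (_×-⇔_)
open import Data.Sum using (_⊎_; inj₁; inj₂)
open import Data.Empty using (⊥-elim)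
open import Function using (_∘_)
open import Function.Bundles using (_⇔_; mk⇔; Equivalence)
import Function.Properties.Equivalence as ⇔
open import Relation.Nullary using (¬_; yes; no; does)
open import Relation.Binary.PropositionalEquality using (_≡_; _≢_; refl; sym; trans; cong; cong₂; subst)
open import Relation.Binary using (IsPartialOrder; IsEquivalence)

open Equivalence using (to; from)

≡ᵇ-refl : ∀ m → (m ≡ᵇ m) ≡ true
≡ᵇ-refl m = to T-≡ (≡⇒≡ᵇ m m refl)

≢⇒≡ᵇ-false : ∀ {m n} → m ≢ n → (m ≡ᵇ n) ≡ false
≢⇒≡ᵇ-false {m} {n} m≢n with m ≡ᵇ n in m≡ᵇn
... | false = refl
... | true = ⊥-elim (m≢n (≡ᵇ⇒≡ m n (subst T (sym m≡ᵇn) _)))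

≡ᵇ-refl≢false : ∀ m → (m ≡ᵇ m) ≢ false
≡ᵇ-refl≢false m eq with trans (sym (≡ᵇ-refl m)) eq
... | ()

∨-introˡ : ∀ {a b} → T a → T (a ∨ b)
∨-introˡ = from T-∨ ∘ inj₁

∨-introʳ : ∀ {a b} → T b → T (a ∨ b)
∨-introʳ = from T-∨ ∘ inj₂

module _ {L : Language} (t : Term L) (x : Var) where

  mutual
    substT-fresh : ∀ u → occursT x u ≡ false → substT x t u ≡ u
    substT-fresh (var y) fresh with y ≟ x
    ... | yes refl = ⊥-elim (≡ᵇ-refl≢false x fresh)
    ... | no y≢x rewrite ≢⇒≡ᵇ-false y≢x = refl
    substT-fresh (fun f us) fresh = cong (fun f) (substV-fresh us fresh)

    substV-fresh : ∀ {n} (us : Vec (Term L) n) → occursV x us ≡ false → substV x t us ≡ us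
    substV-fresh [] _ = refl
    substV-fresh (u ∷ us) fresh =
      cong₂ _∷_ (substT-fresh u (∨-conicalˡ _ _ fresh)) (substV-fresh us (∨-conicalʳ _ _ fresh))

  subst-fresh : ∀ φ → free x φ ≡ false → φ [ t / x ] ≡ φ
  subst-fresh (u ≐ v) fresh =
    cong₂ _≐_ (substT-fresh u (∨-conicalˡ _ _ fresh)) (substT-fresh v (∨-conicalʳ _ _ fresh))
  subst-fresh (rel R us) fresh = cong (rel R) (substV-fresh us fresh)
  subst-fresh (¬′ φ) fresh = cong ¬′ (subst-fresh φ fresh)
  subst-fresh (φ ∧′ ψ) fresh =
    cong₂ _∧′_ (subst-fresh φ (∨-conicalˡ _ _ fresh)) (subst-fresh ψ (∨-conicalʳ _ _ fresh))
  subst-fresh (∀′ y φ) fresh with y ≟ x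
  ... | yes refl rewrite ≡ᵇ-refl y = refl
  ... | no y≢x rewrite ≢⇒≡ᵇ-false y≢x | ≢⇒≡ᵇ-false (y≢x ∘ sym) = cong (∀′ y) (subst-fresh φ fresh)

  subst-∀-≢ : ∀ {y} φ → y ≢ x → (∀′ y φ) [ t / x ] ≡ ∀′ y (φ [ t / x ])
  subst-∀-≢ φ y≢x rewrite ≢⇒≡ᵇ-false y≢x = refl

free-∀-bound : ∀ {L} x (φ : Formula L) → free x (∀′ x φ) ≡ false
free-∀-bound x φ rewrite ≡ᵇ-refl x = refl

module Possibility {L : Language} {ℓ : Level} (M : Model L ℓ) where
  open Model M

  module ⊑ = IsPartialOrder ⊑-po
  module ≍ {s : S} = IsEquivalence (≍-equiv s)

  _[_≔_] : Assignment M → Var → D → Assignment M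
  _[_≔_] = _[_↦_] M

  Agree : (Var → Bool) → Assignment M → Assignment M → Set ℓ
  Agree occurs g g' = ∀ y → T (occurs y) → g y ≡ g' y

  Agree-sym : ∀ {p g g'} → Agree p g g' → Agree p g' g
  Agree-sym ag y = sym ∘ ag y

  ≔-same : ∀ g x a → (g [ x ≔ a ]) x ≡ a
  ≔-same g x a rewrite ≡ᵇ-refl x = refl

  ≔-other : ∀ {x y} → y ≢ x → ∀ g a → (g [ x ≔ a ]) y ≡ g y
  ≔-other y≢x g a rewrite ≢⇒≡ᵇ-false y≢x = refl

  Agree-≔-fresh : ∀ {p y} → p y ≡ false → ∀ g b → Agree p (g [ y ≔ b ]) g
  Agree-≔-fresh {y = y} fresh g b z pz with z ≟ y
  ... | yes refl = ⊥-elim (subst T fresh pz)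
  ... | no z≢y = ≔-other z≢y g b

  ≔-comm : ∀ {x y} → y ≢ x → ∀ g a b z → (g [ x ≔ a ] [ y ≔ b ]) z ≡ (g [ y ≔ b ] [ x ≔ a ]) z
  ≔-comm {x} {y} y≢x g a b z with z ≟ y
  ... | yes refl = trans (≔-same (g [ x ≔ a ]) z b) (sym (trans (≔-other y≢x (g [ z ≔ b ]) a) (≔-same g z b)))
  ... | no z≢y rewrite ≢⇒≡ᵇ-false z≢y = refl

  mutual
    den-pers : ∀ t {s s' g a} → den M s g t a → s' ⊑ s → den M s' g t a
    den-pers (var x) d s'⊑s = ≍-pers d s'⊑s
    den-pers (fun f ts) (as , dv , vf) s'⊑s =
      as , denV-pers ts dv s'⊑s , VF-pers vf s'⊑s (Pointwise.refl ≍.refl) ≍.refl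

    denV-pers : ∀ {n} (ts : Vec (Term L) n) {s s' g as} → denV M s g ts as → s' ⊑ s → denV M s' g ts as
    denV-pers [] {as = []} d _ = d
    denV-pers (t ∷ ts) {as = _ ∷ _} (d , ds) s'⊑s = den-pers t d s'⊑s , denV-pers ts ds s'⊑s

  den-resp-≍ : ∀ t {s g a b} → den M s g t a → a ≍[ s ] b → den M s g t b
  den-resp-≍ (var x) d a≍b = ≍.trans (≍.sym a≍b) d
  den-resp-≍ (fun f ts) (as , dv , vf) a≍b = as , dv , VF-pers vf ⊑.refl (Pointwise.refl ≍.refl) a≍b

  mutual
    den-unique : ∀ t {s g a b} → den M s g t a → den M s g t b → a ≍[ s ] b
    den-unique (var x) d d' = ≍.trans d (≍.sym d')
    den-unique (fun f ts) (as , dv , vf) (bs , dv' , vf') =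
      VF-qf vf (VF-pers vf' ⊑.refl (Pointwise.sym ≍.sym (denV-unique ts dv dv')) ≍.refl)

    denV-unique : ∀ {n} (ts : Vec (Term L) n) {s g as bs} →
                  denV M s g ts as → denV M s g ts bs → Pointwise (λ a b → a ≍[ s ] b) as bs
    denV-unique [] {as = []} {[]} _ _ = []
    denV-unique (t ∷ ts) {as = _ ∷ _} {_ ∷ _} (d , ds) (d' , ds') = den-unique t d d' ∷ denV-unique ts ds ds'

  mutual
    den-eventually-defined : ∀ t s g → ∃ λ s' → s' ⊑ s × Nonempty M s' g t
    den-eventually-defined (var x) s g = s , ⊑.refl , g x , ≍.refl
    den-eventually-defined (fun f ts) s g with denV-eventually-defined ts s g
    ... | s' , s'⊑s , as , dv with VF-ed f s' as
    ... | s'' , s''⊑s' , b , vf = s'' , ⊑.trans s''⊑s' s'⊑s , b , as , denV-pers ts dv s''⊑s' , vf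

    denV-eventually-defined : ∀ {n} (ts : Vec (Term L) n) s g →
                              ∃ λ s' → s' ⊑ s × ∃ (denV M s' g ts)
    denV-eventually-defined [] s g = s , ⊑.refl , [] , lift _
    denV-eventually-defined (t ∷ ts) s g with den-eventually-defined t s g
    ... | s' , s'⊑s , a , d with denV-eventually-defined ts s' g
    ... | s'' , s''⊑s' , as , ds = s'' , ⊑.trans s''⊑s' s'⊑s , a ∷ as , den-pers t d s''⊑s' , ds

  All-Nonempty⇒denV : ∀ {n} (ts : Vec (Term L) n) {s g} → All (Nonempty M s g) ts → ∃ (denV M s g ts)
  All-Nonempty⇒denV [] [] = [] , lift _
  All-Nonempty⇒denV (t ∷ ts) ((a , d) ∷ ne) with All-Nonempty⇒denV ts ne
  ... | as , ds = a ∷ as , d , ds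

  denV⇒All-Nonempty : ∀ {n} (ts : Vec (Term L) n) {s g as} → denV M s g ts as → All (Nonempty M s g) ts
  denV⇒All-Nonempty [] _ = []
  denV⇒All-Nonempty (t ∷ ts) {as = a ∷ _} (d , ds) = (a , d) ∷ denV⇒All-Nonempty ts ds

  sat-≐⇔ : ∀ {s g} t u → sat M s g (t ≐ u) ⇔
           (∀ s' → s' ⊑ s → ∀ a b → den M s' g t a → den M s' g u b → a ≍[ s' ] b)
  sat-≐⇔ t u = mk⇔
    (λ h s' s'⊑s a b da db → den-unique u (proj₁ (h s' s'⊑s (a , da) (b , db)) a da) db)
    (λ h s' s'⊑s (a₀ , da₀) (b₀ , db₀) →
       (λ a da → den-resp-≍ u db₀ (≍.sym (h s' s'⊑s a b₀ da db₀))) ,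
       (λ b db → den-resp-≍ t da₀ (h s' s'⊑s a₀ b da₀ db)))

  sat-rel⇔ : ∀ {s g R} ts → sat M s g (rel R ts) ⇔
             (∀ s' → s' ⊑ s → ∀ as → denV M s' g ts as → VR R s' as)
  sat-rel⇔ {s} {g} {R} ts = mk⇔
    (λ (h : sat M s g (rel R ts)) s' s'⊑s as dv →
       let _ , dv' , vr = h s' s'⊑s (denV⇒All-Nonempty ts dv) in
       VR-pers vr ⊑.refl (denV-unique ts dv' dv))
    (λ h s' s'⊑s ne →
       let as , dv = All-Nonempty⇒denV ts ne in
       as , dv , h s' s'⊑s as dv)

  sat-pers : ∀ φ {s s' g} → sat M s g φ → s' ⊑ s → sat M s' g φ
  sat-pers (t ≐ u) h s'⊑s s'' s''⊑s' = h s'' (⊑.trans s''⊑s' s'⊑s)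
  sat-pers (rel R ts) h s'⊑s s'' s''⊑s' = h s'' (⊑.trans s''⊑s' s'⊑s)
  sat-pers (¬′ φ) h s'⊑s s'' s''⊑s' = h s'' (⊑.trans s''⊑s' s'⊑s)
  sat-pers (φ ∧′ ψ) (hφ , hψ) s'⊑s = sat-pers φ hφ s'⊑s , sat-pers ψ hψ s'⊑s
  sat-pers (∀′ x φ) h s'⊑s a = sat-pers φ (h a) s'⊑s

  record SameDen (s : S) (g g' : Assignment M) (u u' : Term L) : Set ℓ where
    constructor sameDen
    field same : ∀ b → den M s g u b ⇔ den M s g' u' b
  open SameDen

  SameDen-var : ∀ {s g g' x y} → g x ≡ g' y → SameDen s g g' (var x) (var y)
  SameDen-var {s} gx≡g'y = sameDen λ b → mk⇔ (subst (b ≍[ s ]_) gx≡g'y) (subst (b ≍[ s ]_) (sym gx≡g'y))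

  SameDen-sym : ∀ {s g g' u u'} → SameDen s g g' u u' → SameDen s g' g u' u
  SameDen-sym e = sameDen λ b → ⇔.sym (same e b)

  denV-transfer : ∀ {s g g' n} {us us' : Vec (Term L) n} {as} →
                  Pointwise (SameDen s g g') us us' → denV M s g us as → denV M s g' us' as
  denV-transfer {as = []} [] d = d
  denV-transfer {as = a ∷ _} (e ∷ es) (d , ds) = to (same e a) d , denV-transfer es ds

  SameDen-fun : ∀ {s g g'} f {us us'} → Pointwise (SameDen s g g') us us' →
                SameDen s g g' (fun f us) (fun f us')
  SameDen-fun f es = sameDen λ b → mk⇔
    (λ (as , dv , vf) → as , denV-transfer es dv , vf)
    (λ (as , dv , vf) → as , denV-transfer (Pointwise.sym SameDen-sym es) dv , vf)

  sat-≐-transfer : ∀ {s g g' t u t' u'} →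
                   (∀ s' → s' ⊑ s → SameDen s' g g' t t') → (∀ s' → s' ⊑ s → SameDen s' g g' u u') →
                   sat M s g (t ≐ u) → sat M s g' (t' ≐ u')
  sat-≐-transfer {t = t} {u} {t'} {u'} et eu h = from (sat-≐⇔ t' u') λ s' s'⊑s a b da db →
    to (sat-≐⇔ t u) h s' s'⊑s a b (from (same (et s' s'⊑s) a) da) (from (same (eu s' s'⊑s) b) db)

  sat-rel-transfer : ∀ {s g g' R ts ts'} → (∀ s' → s' ⊑ s → Pointwise (SameDen s' g g') ts ts') →
                     sat M s g (rel R ts) → sat M s g' (rel R ts')
  sat-rel-transfer {ts = ts} {ts'} e h = from (sat-rel⇔ ts') λ s' s'⊑s as dv →
    to (sat-rel⇔ ts) h s' s'⊑s as (denV-transfer (Pointwise.sym SameDen-sym (e s' s'⊑s)) dv)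

  mutual
    den-coincidence : ∀ u {s g g'} → Agree (λ y → occursT y u) g g' → SameDen s g g' u u
    den-coincidence (var x) ag = SameDen-var (ag x (≡⇒≡ᵇ x x refl))
    den-coincidence (fun f us) ag = SameDen-fun f (denV-coincidence us ag)

    denV-coincidence : ∀ {n} (us : Vec (Term L) n) {s g g'} → Agree (λ y → occursV y us) g g' →
                       Pointwise (SameDen s g g') us us
    denV-coincidence [] ag = []
    denV-coincidence (u ∷ us) ag =
      den-coincidence u (λ y → ag y ∘ ∨-introˡ) ∷ denV-coincidence us (λ y → ag y ∘ ∨-introʳ {occursT y u})

  Agree-∀-≔ : ∀ g g' x (φ : Formula L) a → Agree (λ y → free y (∀′ x φ)) g g' →
              Agree (λ y → free y φ) (g [ x ≔ a ]) (g' [ x ≔ a ])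
  Agree-∀-≔ g g' x φ a ag y fy with y ≟ x
  ... | yes refl = trans (≔-same g y a) (sym (≔-same g' y a))
  ... | no y≢x = trans (≔-other y≢x g a) (trans (ag y y-free) (sym (≔-other y≢x g' a)))
    where
    y-free : T (free y (∀′ x φ))
    y-free = subst (λ b → T (not b ∧ free y φ)) (sym (≢⇒≡ᵇ-false y≢x)) fy

  sat-coincidence : ∀ φ {s g g'} → Agree (λ y → free y φ) g g' → sat M s g φ → sat M s g' φ
  sat-coincidence (t ≐ u) ag = sat-≐-transfer
    (λ _ _ → den-coincidence t (λ y → ag y ∘ ∨-introˡ))
    (λ _ _ → den-coincidence u (λ y → ag y ∘ ∨-introʳ {occursT y t}))
  sat-coincidence (rel R ts) ag = sat-rel-transfer λ _ _ → denV-coincidence ts ag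
  sat-coincidence (¬′ φ) ag h s' s'⊑s hφ = h s' s'⊑s (sat-coincidence φ (Agree-sym ag) hφ)
  sat-coincidence (φ ∧′ ψ) ag (hφ , hψ) =
    sat-coincidence φ (λ y → ag y ∘ ∨-introˡ) hφ , sat-coincidence ψ (λ y → ag y ∘ ∨-introʳ {free y φ}) hψ
  sat-coincidence (∀′ x φ) {g = g} {g'} ag h a = sat-coincidence φ (Agree-∀-≔ g g' x φ a ag) (h a)

  sat-≗ : ∀ φ {s g g'} → (∀ z → g z ≡ g' z) → sat M s g φ → sat M s g' φ
  sat-≗ φ g≗g' = sat-coincidence φ (λ z _ → g≗g' z)

  module _ {t : Term L} {x : Var} where

    mutual
      den-substT : ∀ {s g a} → den M s g t a → ∀ u → SameDen s g (g [ x ≔ a ]) (substT x t u) u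
      den-substT {s} {g} {a} dt (var y) with y ≟ x
      ... | yes refl rewrite ≡ᵇ-refl y = sameDen λ b → mk⇔
        (λ d → subst (b ≍[ s ]_) (sym (≔-same g y a)) (den-unique t d dt))
        (λ b≍a → den-resp-≍ t dt (≍.sym (subst (b ≍[ s ]_) (≔-same g y a) b≍a)))
      ... | no y≢x rewrite ≢⇒≡ᵇ-false y≢x = SameDen-var (sym (≔-other y≢x g a))
      den-substT dt (fun f us) = SameDen-fun f (denV-substV dt us)

      denV-substV : ∀ {s g a} → den M s g t a → ∀ {n} (us : Vec (Term L) n) →
                    Pointwise (SameDen s g (g [ x ≔ a ])) (substV x t us) us
      denV-substV dt [] = []
      denV-substV dt (u ∷ us) = den-substT dt u ∷ denV-substV dt us

    sat-subst-fresh : ∀ φ → free x φ ≡ false → ∀ {s g a} →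
                      sat M s (g [ x ≔ a ]) φ ⇔ sat M s g (φ [ t / x ])
    sat-subst-fresh φ fresh {g = g} {a} rewrite subst-fresh t x φ fresh = mk⇔
      (sat-coincidence φ (Agree-≔-fresh fresh g a))
      (sat-coincidence φ (Agree-sym (Agree-≔-fresh fresh g a)))

    -- In the ∀′ y case with y ≢ x, substitutability makes y fresh in t, so
    -- the denotation of t survives updating y and the two updates commute.
    sat-subst : ∀ φ → T (substitutable t x φ) → ∀ {s g a} → den M s g t a →
                sat M s (g [ x ≔ a ]) φ ⇔ sat M s g (φ [ t / x ])
    sat-subst (u ≐ v) _ dt = mk⇔
      (sat-≐-transfer (λ _ s'⊑s → SameDen-sym (den-substT (den-pers t dt s'⊑s) u))
                      (λ _ s'⊑s → SameDen-sym (den-substT (den-pers t dt s'⊑s) v)))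
      (sat-≐-transfer (λ _ s'⊑s → den-substT (den-pers t dt s'⊑s) u)
                      (λ _ s'⊑s → den-substT (den-pers t dt s'⊑s) v))
    sat-subst (rel R us) _ dt = mk⇔
      (sat-rel-transfer λ _ s'⊑s → Pointwise.sym SameDen-sym (denV-substV (den-pers t dt s'⊑s) us))
      (sat-rel-transfer λ _ s'⊑s → denV-substV (den-pers t dt s'⊑s) us)
    sat-subst (¬′ φ) sb dt = mk⇔
      (λ h s' s'⊑s k → h s' s'⊑s (from (sat-subst φ sb (den-pers t dt s'⊑s)) k))
      (λ h s' s'⊑s k → h s' s'⊑s (to (sat-subst φ sb (den-pers t dt s'⊑s)) k))
    sat-subst (φ ∧′ ψ) sb dt with to T-∧ sb
    ... | sbφ , sbψ = sat-subst φ sbφ dt ×-⇔ sat-subst ψ sbψ dt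
    sat-subst (∀′ y φ) sb dt with to T-∨ sb
    ... | inj₁ fresh = sat-subst-fresh (∀′ y φ) (to T-not-≡ fresh)
    ... | inj₂ sb′ with y ≟ x
    ...   | yes refl = sat-subst-fresh (∀′ x φ) (free-∀-bound x φ)
    sat-subst (∀′ y φ) _ {s} {g} {a} dt | inj₂ sb′ | no y≢x rewrite subst-∀-≢ t x φ y≢x = mk⇔
      (λ h b → to (ih b) (sat-≗ φ (≔-comm y≢x g a b) (h b)))
      (λ h b → sat-≗ φ (sym ∘ ≔-comm y≢x g a b) (from (ih b) (h b)))
      where
      ih : ∀ b → sat M s (g [ y ≔ b ] [ x ≔ a ]) φ ⇔ sat M s (g [ y ≔ b ]) (φ [ t / x ])
      ih b with to T-∧ sb′
      ... | y-fresh , sbφ = sat-subst φ sbφ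
        (to (same (den-coincidence t (Agree-sym (Agree-≔-fresh (to T-not-≡ y-fresh) g b))) a) dt)

  mutual
    den-replT : ∀ {x y s g u u'} → g x ≍[ s ] g y → ReplT x y u u' → SameDen s g g u u'
    den-replT _ (keep z) = sameDen λ _ → ⇔.refl
    den-replT gx≍gy swap = sameDen λ _ → mk⇔ (λ d → ≍.trans d gx≍gy) (λ d → ≍.trans d (≍.sym gx≍gy))
    den-replT gx≍gy (cfun f r) = SameDen-fun f (den-replV gx≍gy r)

    den-replV : ∀ {x y s g n} {us us' : Vec (Term L) n} → g x ≍[ s ] g y → ReplV x y us us' →
                Pointwise (SameDen s g g) us us'
    den-replV _ [] = []
    den-replV gx≍gy (r ∷ rs) = den-replT gx≍gy r ∷ den-replV gx≍gy rs

  sat-replAtom : ∀ {x y α α' s g} → ReplAtom x y α α' → (∀ s' → s' ⊑ s → g x ≍[ s' ] g y) →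
                 sat M s g α → sat M s g α'
  sat-replAtom (req r₁ r₂) e =
    sat-≐-transfer (λ s' s'⊑s → den-replT (e s' s'⊑s) r₁) (λ s' s'⊑s → den-replT (e s' s'⊑s) r₂)
  sat-replAtom (rrel R rs) e = sat-rel-transfer λ s' s'⊑s → den-replV (e s' s'⊑s) rs

  module Classical (em : ExcludedMiddle ℓ) where

    dne : {P : Set ℓ} → ¬ ¬ P → P
    dne = em⇒dne em

    DenselySat : S → Assignment M → Formula L → Set ℓ
    DenselySat s g φ = ∀ s' → s' ⊑ s → ¬ ¬ (∃ λ s'' → s'' ⊑ s' × sat M s'' g φ)

    DenselySat-map : ∀ {s g g'} φ ψ → (∀ {s'} → sat M s' g φ → sat M s' g' ψ) →
                     DenselySat s g φ → DenselySat s g' ψ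
    DenselySat-map _ _ f dense s' s'⊑s k = dense s' s'⊑s λ (s'' , s''⊑s' , h) → k (s'' , s''⊑s' , f h)

    -- For atoms: if the atom failed at s' for some denotations, refinability of
    -- ≍ (resp. V(R,·)) gives a refinement where it fails for good, which the
    -- density hypothesis then contradicts.
    sat-refinable : ∀ φ {s g} → DenselySat s g φ → sat M s g φ
    sat-refinable (t ≐ u) dense = from (sat-≐⇔ t u) λ s' s'⊑s a b da db → dne λ a≭b →
      let s₁ , s₁⊑s' , never = ≍-ref a≭b in
      dense s₁ (⊑.trans s₁⊑s' s'⊑s) λ (s₂ , s₂⊑s₁ , h) →
        let s₂⊑s' = ⊑.trans s₂⊑s₁ s₁⊑s' in
        never s₂ s₂⊑s₁ (to (sat-≐⇔ t u) h s₂ ⊑.refl a b (den-pers t da s₂⊑s') (den-pers u db s₂⊑s'))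
    sat-refinable (rel R ts) dense = from (sat-rel⇔ ts) λ s' s'⊑s as dv → dne λ ¬VR →
      let s₁ , s₁⊑s' , never = VR-ref ¬VR in
      dense s₁ (⊑.trans s₁⊑s' s'⊑s) λ (s₂ , s₂⊑s₁ , h) →
        never s₂ s₂⊑s₁ (to (sat-rel⇔ ts) h s₂ ⊑.refl as (denV-pers ts dv (⊑.trans s₂⊑s₁ s₁⊑s')))
    sat-refinable (¬′ φ) dense s' s'⊑s h =
      dense s' s'⊑s λ (s'' , s''⊑s' , k) → k s'' ⊑.refl (sat-pers φ h s''⊑s')
    sat-refinable (φ ∧′ ψ) dense =
      sat-refinable φ (DenselySat-map (φ ∧′ ψ) φ proj₁ dense) ,
      sat-refinable ψ (DenselySat-map (φ ∧′ ψ) ψ proj₂ dense)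
    sat-refinable (∀′ x φ) dense a = sat-refinable φ (DenselySat-map (∀′ x φ) φ (λ h → h a) dense)

    sat-⇒-intro : ∀ φ ψ {s g} → (∀ s' → s' ⊑ s → sat M s' g φ → sat M s' g ψ) → sat M s g (φ ⇒ ψ)
    sat-⇒-intro _ _ f s' s'⊑s (hφ , ¬hψ) = ¬hψ s' ⊑.refl (f s' s'⊑s hφ)

    sat-mp : ∀ φ ψ {s g} → sat M s g (φ ⇒ ψ) → sat M s g φ → sat M s g ψ
    sat-mp φ ψ imp hφ = sat-refinable ψ λ s' s'⊑s k →
      imp s' s'⊑s (sat-pers φ hφ s'⊑s , λ s'' s''⊑s' hψ → k (s'' , s''⊑s' , hψ))

    Decided : S → Assignment M → Formula L → Set ℓ
    Decided s g φ = sat M s g φ ⊎ sat M s g (¬′ φ)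

    Settled : S → Assignment M → Formula L → Set ℓ
    Settled s g (¬′ φ) = Settled s g φ
    Settled s g (φ ∧′ ψ) = Settled s g φ × Settled s g ψ
    Settled s g φ@(_ ≐ _) = Decided s g φ
    Settled s g φ@(rel _ _) = Decided s g φ
    Settled s g φ@(∀′ _ _) = Decided s g φ

    Decided-pers : ∀ φ {s s' g} → Decided s g φ → s' ⊑ s → Decided s' g φ
    Decided-pers φ (inj₁ h) s'⊑s = inj₁ (sat-pers φ h s'⊑s)
    Decided-pers φ (inj₂ h) s'⊑s = inj₂ (sat-pers (¬′ φ) h s'⊑s)

    Settled-pers : ∀ φ {s s' g} → Settled s g φ → s' ⊑ s → Settled s' g φ
    Settled-pers (¬′ φ) st = Settled-pers φ st
    Settled-pers (φ ∧′ ψ) (stφ , stψ) s'⊑s = Settled-pers φ stφ s'⊑s , Settled-pers ψ stψ s'⊑s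
    Settled-pers φ@(_ ≐ _) = Decided-pers φ
    Settled-pers φ@(rel _ _) = Decided-pers φ
    Settled-pers φ@(∀′ _ _) = Decided-pers φ

    decide-below : ∀ φ s g → ∃ λ s' → s' ⊑ s × Decided s' g φ
    decide-below φ s g with em {∃ λ s' → s' ⊑ s × sat M s' g φ}
    ... | yes (s' , s'⊑s , h) = s' , s'⊑s , inj₁ h
    ... | no ¬h = s , ⊑.refl , inj₂ λ s' s'⊑s h → ¬h (s' , s'⊑s , h)

    settle-below : ∀ φ s g → ∃ λ s' → s' ⊑ s × Settled s' g φ
    settle-below (¬′ φ) s g = settle-below φ s g
    settle-below (φ ∧′ ψ) s g with settle-below φ s g
    ... | s' , s'⊑s , stφ with settle-below ψ s' g
    ... | s'' , s''⊑s' , stψ = s'' , ⊑.trans s''⊑s' s'⊑s , Settled-pers φ stφ s''⊑s' , stψ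
    settle-below φ@(_ ≐ _) = decide-below φ
    settle-below φ@(rel _ _) = decide-below φ
    settle-below φ@(∀′ _ _) = decide-below φ

    Verdict : S → Assignment M → Formula L → Bool → Set ℓ
    Verdict s g φ b = if b then sat M s g φ else sat M s g (¬′ φ)

    module _ (s : S) (g : Assignment M) where

      valuation : Formula L → Bool
      valuation φ = does (em {sat M s g φ})

      Verdict-valuation : ∀ φ → Decided s g φ → Verdict s g φ (valuation φ)
      Verdict-valuation φ d with em {sat M s g φ} | d
      ... | yes h | _ = h
      ... | no ¬h | inj₁ h = ⊥-elim (¬h h)
      ... | no _ | inj₂ h = h

      Verdict-¬ : ∀ φ b → Verdict s g φ b → Verdict s g (¬′ φ) (not b)
      Verdict-¬ φ true h s' s'⊑s k = k s' ⊑.refl (sat-pers φ h s'⊑s)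
      Verdict-¬ φ false h = h

      Verdict-∧ : ∀ φ ψ b c → Verdict s g φ b → Verdict s g ψ c → Verdict s g (φ ∧′ ψ) (b ∧ c)
      Verdict-∧ φ ψ true true hφ hψ = hφ , hψ
      Verdict-∧ φ ψ true false _ ¬hψ s' s'⊑s (_ , hψ) = ¬hψ s' s'⊑s hψ
      Verdict-∧ φ ψ false _ ¬hφ _ s' s'⊑s (hφ , _) = ¬hφ s' s'⊑s hφ

      Verdict-evalP : ∀ φ → Settled s g φ → Verdict s g φ (evalP valuation φ)
      Verdict-evalP (¬′ φ) st = Verdict-¬ φ _ (Verdict-evalP φ st)
      Verdict-evalP (φ ∧′ ψ) (stφ , stψ) = Verdict-∧ φ ψ _ _ (Verdict-evalP φ stφ) (Verdict-evalP ψ stψ)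
      Verdict-evalP φ@(_ ≐ _) = Verdict-valuation φ
      Verdict-evalP φ@(rel _ _) = Verdict-valuation φ
      Verdict-evalP φ@(∀′ _ _) = Verdict-valuation φ

    sat-tautology : ∀ φ → Tautology φ → ∀ s g → sat M s g φ
    sat-tautology φ taut s g = sat-refinable φ λ s' _ k →
      let s'' , s''⊑s' , st = settle-below φ s' g in
      k (s'' , s''⊑s' , subst (Verdict s'' g φ) (taut (valuation s'' g)) (Verdict-evalP s'' g φ st))

    sat-baseAxiom : ∀ {φ} → BaseAxiom φ → ∀ s g → sat M s g φ
    sat-baseAxiom (ax-taut {φ} taut) = sat-tautology φ taut
    sat-baseAxiom (ax-inst {x} {φ} {t} sb) s g = sat-⇒-intro (∀′ x φ) (φ [ t / x ]) λ s₁ _ h →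
      sat-refinable (φ [ t / x ]) λ s₂ s₂⊑s₁ k →
        let s₃ , s₃⊑s₂ , a , dt = den-eventually-defined t s₂ g in
        k (s₃ , s₃⊑s₂ , to (sat-subst φ sb dt) (sat-pers φ (h a) (⊑.trans s₃⊑s₂ s₂⊑s₁)))
    sat-baseAxiom (ax-dist {x} {φ} {ψ}) s g =
      sat-⇒-intro (∀′ x (φ ⇒ ψ)) (∀′ x φ ⇒ ∀′ x ψ) λ _ _ h →
      sat-⇒-intro (∀′ x φ) (∀′ x ψ) λ _ s₂⊑s₁ h′ a →
      sat-mp φ ψ (sat-pers (φ ⇒ ψ) (h a) s₂⊑s₁) (h′ a)
    sat-baseAxiom (ax-vac {x} {φ} fresh) s g = sat-⇒-intro φ (∀′ x φ) λ _ _ h a →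
      sat-coincidence φ (Agree-sym (Agree-≔-fresh (to T-not-≡ fresh) g a)) h
    sat-baseAxiom (ax-refl {x}) s g = from (sat-≐⇔ {g = g} (var x) (var x)) λ _ _ a b da db → ≍.trans da (≍.sym db)
    sat-baseAxiom (ax-leib {x} {y} {α} {α'} r) s g =
      sat-⇒-intro (var x ≐ var y) (α ⇒ α') λ _ _ hxy →
      sat-⇒-intro α α' λ _ s₂⊑s₁ →
      sat-replAtom r λ s₃ s₃⊑s₂ →
        to (sat-≐⇔ (var x) (var y)) hxy s₃ (⊑.trans s₃⊑s₂ s₂⊑s₁) (g x) (g y) ≍.refl ≍.refl

    sat-logicalAxiom : ∀ {φ} → LogicalAxiom φ → ∀ s g → sat M s g φ
    sat-logicalAxiom (base ax) = sat-baseAxiom ax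
    sat-logicalAxiom (gen x ax) s g a = sat-logicalAxiom ax s (g [ x ≔ a ])

    soundness : ∀ {Γ φ} → Γ ⊢ φ → ∀ s g → (∀ ψ → Γ ψ → sat M s g ψ) → sat M s g φ
    soundness (assum {φ} Γφ) s g ⊩Γ = ⊩Γ φ Γφ
    soundness (axiom ax) s g _ = sat-logicalAxiom ax s g
    soundness (mp {φ} {ψ} d e) s g ⊩Γ = sat-mp φ ψ (soundness d s g ⊩Γ) (soundness e s g ⊩Γ)

theorem4p2p4 : (L : Language) (Γ : Formula L → Set) (φ : Formula L) →
    Γ ⊢ φ →
    {ℓ : Level} → ExcludedMiddle ℓ →
    (M : Model L ℓ) (s : Model.S M) (g : Assignment M) →
    (∀ ψ → Γ ψ → sat M s g ψ) → sat M s g φ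
theorem4p2p4 L Γ φ Γ⊢φ em M = Possibility.Classical.soundness M em Γ⊢φ
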